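{- Let $C(k)$ be defined as in the context. Then $C(k)=\Omega(k\log k)$; that is, there is an absolute constant $c>0$ such that $C(k)\ge c\,k\log k$ for all sufficiently large $k$.
   Context: All graphs are finite, simple and undirected. The repetition number of a graph is the maximum number of its vertices having the same degree. For a positive integer $k$, $C(k)$ denotes the least integer $C$ such that every graph with $n$ vertices (for every $n$) has an induced subgraph with at least $n-C$ vertices whose repetition number is at least $\min\{k,n-C\}$ (degrees computed in the induced subgraph). -}

module Defs where

open import Data.Nat using (ℕ; zero; suc; _+_; _∸_; _≤_; _⊓_; _⊔_; _≡ᵇ_)
open import Data.Bool using (Bool; true; false; if_then_else_; _∧_)
open import Data.Fin using (Fin; zero; suc)
open import Data.List using (List; foldr; map; upTo)
open import Data.Product using (∃; _×_)
open import Relation.Binary.PropositionalEquality using (_≡_)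

record Graph (n : ℕ) : Set where
  field
    adj    : Fin n → Fin n → Bool
    sym    : ∀ i j → adj i j ≡ adj j i
    irrefl : ∀ i → adj i i ≡ false
open Graph public

count : ∀ {n} → (Fin n → Bool) → ℕ
count {zero}  f = 0
count {suc n} f = (if f zero then 1 else 0) + count (λ i → f (suc i))

-- A vertex subset (the vertex set of an induced subgraph).
VSet : ℕ → Set
VSet n = Fin n → Bool

size : ∀ {n} → VSet n → ℕ
size S = count S

degIn : ∀ {n} → Graph n → VSet n → Fin n → ℕ
degIn G S v = count (λ u → S u ∧ adj G u v)

mult : ∀ {n} → Graph n → VSet n → ℕ → ℕ
mult G S d = count (λ v → S v ∧ (degIn G S v ≡ᵇ d))

-- Repetition number of G[S]: maximum number of its vertices with the same
-- degree (degrees range over 0 .. n; 0 for the empty graph).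
repetition : ∀ {n} → Graph n → VSet n → ℕ
repetition {n} G S = foldr _⊔_ 0 (map (mult G S) (upTo (suc n)))

-- C is admissible for k: every graph on n vertices has an induced subgraph
-- with at least n - C vertices and repetition number ≥ min{k, n - C}.
-- C(k) is the least admissible C.
Admissible : ℕ → ℕ → Set
Admissible k C =
  ∀ n (G : Graph n) → ∃ λ (S : VSet n) →
    (n ∸ C ≤ size S) × (k ⊓ (n ∸ C) ≤ repetition G S)

module Submission where

open import Defs
open import Data.Nat using (ℕ; _*_; _≤_)
open import Data.Nat.Logarithm using (⌊log₂_⌋)
open import Data.Product using (∃₂)

open import Data.Nat using (zero; suc; _+_; _∸_; _<_; _^_; _⊓_; _⊔_; _≡ᵇ_; z≤n; s≤s; _≤?_; ⌊_/2⌋; ⌈_/2⌉)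
open import Data.Nat.Properties
open import Data.Nat.Logarithm using (⌊log₂⌊n/2⌋⌋≡⌊log₂n⌋∸1; ⌊log₂⌋-mono-≤; ⌊log₂[2^n]⌋≡n)
open import Data.Nat.Solver using (module +-*-Solver)
open import Data.Bool using (Bool; true; false; if_then_else_; _∧_; not; T)
open import Data.Bool.Properties using (∧-identityʳ; ∧-zeroʳ)
open import Data.Fin using (Fin; zero; suc; splitAt; _↑ˡ_; _↑ʳ_)
open import Data.Fin.Properties using (splitAt-↑ˡ; splitAt-↑ʳ)
open import Data.Sum using (_⊎_; inj₁; inj₂)
open import Data.Product using (_×_; _,_; ∃; proj₁; proj₂)
open import Data.List using ([]; _∷_; foldr; map; upTo)
open import Data.Empty using (⊥-elim)
open import Relation.Nullary using (yes; no)
open import Relation.Binary.PropositionalEquality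
  using (_≡_; refl; trans; cong; cong₂; subst; subst₂)
  renaming (sym to ≡-sym)

-- Let G₀ = K₁ and G_{L+1} = G_L ⊕ G_L ⊕ K_{2^{L+1}} (disjoint unions).  G_L has
-- (L+1)·2^L vertices.  In an induced subgraph of a clique K_p, the vertices of
-- degree d number either 0 or exactly d+1 (and then d+1 ≤ p).  Multiplicities
-- add over disjoint unions, so by induction on L every induced subgraph of G_L
-- has at most 2^{L+1} ∸ (d+1) vertices of degree d; in particular its
-- repetition number is at most 2^{L+1}.  If C is admissible for k and the
-- repetition numbers of all induced subgraphs of an n-vertex graph are at most
-- R < k, then n ∸ C ≤ R, i.e. n ≤ C + R.  Applied to G_L with 2^{L+1} < k this
-- gives (L+1)·2^L ≤ C + 2^{L+1}.  Choosing L = ⌊log₂ k⌋ ∸ 2 yields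
-- k·⌊log₂ k⌋ ≤ 32·C for k ≥ 16.

count-ext : ∀ {n} {f g : Fin n → Bool} → (∀ i → f i ≡ g i) → count f ≡ count g
count-ext {zero}          h = refl
count-ext {suc n} {f} {g} h rewrite h zero = cong (_ +_) (count-ext (λ i → h (suc i)))

count-false : ∀ {n} {f : Fin n → Bool} → (∀ i → f i ≡ false) → count f ≡ 0
count-false {zero}      h = refl
count-false {suc n} {f} h rewrite h zero = count-false (λ i → h (suc i))

count-split : ∀ m n (f : Fin (m + n) → Bool) →
  count f ≡ count (λ i → f (i ↑ˡ n)) + count (λ i → f (m ↑ʳ i))
count-split zero    n f = refl
count-split (suc m) n f =
  trans (cong ((if f zero then 1 else 0) +_) (count-split m n (λ i → f (suc i))))
        (≡-sym (+-assoc (if f zero then 1 else 0) _ _))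

count-≤ : ∀ {n} (f : Fin n → Bool) → count f ≤ n
count-≤ {zero}  f = z≤n
count-≤ {suc n} f with f zero
... | true  = s≤s (count-≤ (λ i → f (suc i)))
... | false = m≤n⇒m≤1+n (count-≤ (λ i → f (suc i)))

count-mono : ∀ {n} (f g : Fin n → Bool) → (∀ i → f i ≡ true → g i ≡ true) →
  count f ≤ count g
count-mono {zero}  f g h = z≤n
count-mono {suc n} f g h with f zero in ef | g zero in eg
... | true  | true  = s≤s (count-mono _ _ (λ i → h (suc i)))
... | true  | false with () ← trans (≡-sym eg) (h zero ef)
... | false | true  = m≤n⇒m≤1+n (count-mono _ _ (λ i → h (suc i)))
... | false | false = count-mono _ _ (λ i → h (suc i))

count-witness : ∀ {n} (f : Fin n → Bool) → 0 < count f → ∃ λ i → f i ≡ true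
count-witness {zero}  f ()
count-witness {suc n} f pos with f zero in e
... | true  = zero , e
... | false with count-witness (λ i → f (suc i)) pos
...   | i , fi = suc i , fi

∧-true : ∀ {a b} → a ∧ b ≡ true → a ≡ true × b ≡ true
∧-true {true} {true} _ = refl , refl

repetition-≤ : ∀ {n} (G : Graph n) (S : VSet n) R → (∀ d → mult G S d ≤ R) →
  repetition G S ≤ R
repetition-≤ {n} G S R bound = maxOf (upTo (suc n))
  where
  maxOf : ∀ ds → foldr _⊔_ 0 (map (mult G S) ds) ≤ R
  maxOf []       = z≤n
  maxOf (d ∷ ds) = ⊔-lub (bound d) (maxOf ds)

-- If C is admissible for k, then an n-vertex graph all of whose induced
-- subgraphs have repetition number at most R < k satisfies n ≤ C + R:
-- the minimum min{k, n ∸ C} must be n ∸ C, and it is at most R.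
admissible-lower-bound : ∀ {k n R} C → Admissible k C → (G : Graph n) →
  (∀ S → repetition G S ≤ R) → R < k → n ≤ C + R
admissible-lower-bound {k} {n} {R} C adm G rep≤R R<k =
  ≤-trans (m≤n+m∸n n C) (+-monoʳ-≤ C remaining≤R)
  where
  S = proj₁ (adm n G)
  min≤R : k ⊓ (n ∸ C) ≤ R
  min≤R = ≤-trans (proj₂ (proj₂ (adm n G))) (rep≤R S)
  remaining≤R : n ∸ C ≤ R
  remaining≤R with ≤-total k (n ∸ C)
  ... | inj₁ k≤ = ⊥-elim (<⇒≱ R<k (subst (_≤ R) (m≤n⇒m⊓n≡m k≤) min≤R))
  ... | inj₂ ≤k = subst (_≤ R) (m≥n⇒m⊓n≡n ≤k) min≤R

adj-⊎ : ∀ {m n} → Graph m → Graph n → Fin m ⊎ Fin n → Fin m ⊎ Fin n → Bool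
adj-⊎ G H (inj₁ a) (inj₁ b) = adj G a b
adj-⊎ G H (inj₂ a) (inj₂ b) = adj H a b
adj-⊎ G H (inj₁ a) (inj₂ b) = false
adj-⊎ G H (inj₂ a) (inj₁ b) = false

adj-⊎-sym : ∀ {m n} (G : Graph m) (H : Graph n) x y → adj-⊎ G H x y ≡ adj-⊎ G H y x
adj-⊎-sym G H (inj₁ a) (inj₁ b) = sym G a b
adj-⊎-sym G H (inj₂ a) (inj₂ b) = sym H a b
adj-⊎-sym G H (inj₁ a) (inj₂ b) = refl
adj-⊎-sym G H (inj₂ a) (inj₁ b) = refl

adj-⊎-irrefl : ∀ {m n} (G : Graph m) (H : Graph n) x → adj-⊎ G H x x ≡ false
adj-⊎-irrefl G H (inj₁ a) = irrefl G a
adj-⊎-irrefl G H (inj₂ a) = irrefl H a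

_⊕_ : ∀ {m n} → Graph m → Graph n → Graph (m + n)
_⊕_ {m} G H = record
  { adj    = λ x y → adj-⊎ G H (splitAt m x) (splitAt m y)
  ; sym    = λ x y → adj-⊎-sym G H (splitAt m x) (splitAt m y)
  ; irrefl = λ x → adj-⊎-irrefl G H (splitAt m x)
  }

module DisjointUnion {m n} (G : Graph m) (H : Graph n) (S : VSet (m + n)) where

  Sˡ : VSet m
  Sˡ i = S (i ↑ˡ n)

  Sʳ : VSet n
  Sʳ i = S (m ↑ʳ i)

  degIn-left : ∀ v → degIn (G ⊕ H) S (v ↑ˡ n) ≡ degIn G Sˡ v
  degIn-left v = trans (count-split m n _)
    (trans (cong₂ _+_ (count-ext λ a → cong (Sˡ a ∧_) (same a))
                      (count-false λ b → trans (cong (Sʳ b ∧_) (across b)) (∧-zeroʳ _)))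
           (+-identityʳ _))
    where
    same : ∀ a → adj-⊎ G H (splitAt m (a ↑ˡ n)) (splitAt m (v ↑ˡ n)) ≡ adj G a v
    same a rewrite splitAt-↑ˡ m a n | splitAt-↑ˡ m v n = refl
    across : ∀ b → adj-⊎ G H (splitAt m (m ↑ʳ b)) (splitAt m (v ↑ˡ n)) ≡ false
    across b rewrite splitAt-↑ʳ m n b | splitAt-↑ˡ m v n = refl

  degIn-right : ∀ v → degIn (G ⊕ H) S (m ↑ʳ v) ≡ degIn H Sʳ v
  degIn-right v = trans (count-split m n _)
    (cong₂ _+_ (count-false λ a → trans (cong (Sˡ a ∧_) (across a)) (∧-zeroʳ _))
               (count-ext λ b → cong (Sʳ b ∧_) (same b)))
    where
    across : ∀ a → adj-⊎ G H (splitAt m (a ↑ˡ n)) (splitAt m (m ↑ʳ v)) ≡ false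
    across a rewrite splitAt-↑ˡ m a n | splitAt-↑ʳ m n v = refl
    same : ∀ b → adj-⊎ G H (splitAt m (m ↑ʳ b)) (splitAt m (m ↑ʳ v)) ≡ adj H b v
    same b rewrite splitAt-↑ʳ m n b | splitAt-↑ʳ m n v = refl

  mult-⊕ : ∀ d → mult (G ⊕ H) S d ≡ mult G Sˡ d + mult H Sʳ d
  mult-⊕ d = trans (count-split m n _)
    (cong₂ _+_ (count-ext λ a → cong (λ e → Sˡ a ∧ (e ≡ᵇ d)) (degIn-left a))
               (count-ext λ b → cong (λ e → Sʳ b ∧ (e ≡ᵇ d)) (degIn-right b)))

sameFin : ∀ {n} → Fin n → Fin n → Bool
sameFin zero    zero    = true
sameFin zero    (suc _) = false
sameFin (suc _) zero    = false
sameFin (suc a) (suc b) = sameFin a b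

sameFin-sym : ∀ {n} (a b : Fin n) → not (sameFin a b) ≡ not (sameFin b a)
sameFin-sym zero    zero    = refl
sameFin-sym zero    (suc _) = refl
sameFin-sym (suc _) zero    = refl
sameFin-sym (suc a) (suc b) = sameFin-sym a b

sameFin-refl : ∀ {n} (a : Fin n) → not (sameFin a a) ≡ false
sameFin-refl zero    = refl
sameFin-refl (suc a) = sameFin-refl a

Complete : ∀ p → Graph p
Complete p = record { adj = λ u v → not (sameFin u v) ; sym = sameFin-sym ; irrefl = sameFin-refl }

degIn-complete : ∀ {p} (S : VSet p) v → S v ≡ true → suc (degIn (Complete p) S v) ≡ size S
degIn-complete {suc p} S zero    Sv rewrite Sv =
  cong suc (count-ext λ i → ∧-identityʳ (S (suc i)))
degIn-complete {suc p} S (suc w) Sw with S zero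
... | true  = cong suc (degIn-complete (λ i → S (suc i)) w Sw)
... | false = degIn-complete (λ i → S (suc i)) w Sw

-- The possible numbers c of vertices of degree d in an induced subgraph of K_p.
CliqueCount : ℕ → ℕ → ℕ → Set
CliqueCount p d c = c ≡ 0 ⊎ (c ≤ suc d × suc d ≤ p)

-- If some vertex has degree d in K_p[S], then |S| = d + 1 ≤ p, and the
-- multiplicity of d is at most |S|.
mult-complete : ∀ p (S : VSet p) d → CliqueCount p d (mult (Complete p) S d)
mult-complete p S d with mult (Complete p) S d in eq
... | zero  = inj₁ refl
... | suc c with count-witness (λ v → S v ∧ (degIn (Complete p) S v ≡ᵇ d))
                               (subst (0 <_) (≡-sym eq) (s≤s z≤n))
...   | v , Sv∧deg with ∧-true Sv∧deg
...     | Sv , deg = inj₂ (mult≤ , subst (_≤ p) size≡ (count-≤ S))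
  where
  size≡ : size S ≡ suc d
  size≡ = trans (≡-sym (degIn-complete S v Sv))
                (cong suc (≡ᵇ⇒≡ _ _ (subst T (≡-sym deg) _)))
  mult≤ : suc c ≤ suc d
  mult≤ = subst₂ _≤_ eq size≡ (count-mono _ S (λ i r → proj₁ (∧-true r)))

CliqueCount-≤ : ∀ {p d c} → CliqueCount p d c → c ≤ suc d
CliqueCount-≤ (inj₁ refl)    = z≤n
CliqueCount-≤ (inj₂ (c≤ , _)) = c≤

-- If d + 1 > p everything vanishes; otherwise
-- (p ∸ (d+1)) + (p ∸ (d+1)) + (d+1) + (d+1) = 2p.
clique-step : ∀ {p d a b c} → a ≤ p ∸ suc d → b ≤ p ∸ suc d → CliqueCount p d c →
  a + b + c ≤ 2 * p ∸ suc d
clique-step {p} {d} {a} {b} {c} a≤ b≤ cc with suc d ≤? p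
... | yes s≤p = m+n≤o⇒m≤o∸n (a + b + c) (begin
  a + b + c + suc d        ≤⟨ +-monoˡ-≤ (suc d) (+-mono-≤ (+-mono-≤ a≤ b≤) (CliqueCount-≤ cc)) ⟩
  x + x + suc d + suc d    ≡⟨ regroup x (suc d) ⟩
  (x + suc d) + (x + suc d) ≡⟨ cong₂ _+_ (m∸n+n≡m s≤p) (m∸n+n≡m s≤p) ⟩
  p + p                    ≡⟨ cong (p +_) (≡-sym (+-identityʳ p)) ⟩
  2 * p                    ∎)
  where
  open ≤-Reasoning
  open +-*-Solver
  x = p ∸ suc d
  regroup : ∀ y s → y + y + s + s ≡ (y + s) + (y + s)
  regroup = solve 2 (λ y s → y :+ y :+ s :+ s := (y :+ s) :+ (y :+ s)) refl
... | no s≰p with cc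
...   | inj₂ (_ , s≤p) = ⊥-elim (s≰p s≤p)
...   | inj₁ refl = ≤-trans (+-mono-≤ (+-mono-≤ (vanish a≤) (vanish b≤)) ≤-refl) z≤n
  where
  vanish : ∀ {y} → y ≤ p ∸ suc d → y ≤ 0
  vanish {y} = subst (y ≤_) (m≤n⇒m∸n≡0 (<⇒≤ (≰⇒> s≰p)))

order : ℕ → ℕ
order zero    = 1
order (suc L) = order L + order L + 2 ^ suc L

Layered : ∀ L → Graph (order L)
Layered zero    = Complete 1
Layered (suc L) = (Layered L ⊕ Layered L) ⊕ Complete (2 ^ suc L)

order-closed : ∀ L → order L ≡ suc L * 2 ^ L
order-closed zero    = refl
order-closed (suc L) rewrite order-closed L = identity L (2 ^ L)
  where
  open +-*-Solver
  identity : ∀ l q → suc l * q + suc l * q + 2 * q ≡ suc (suc l) * (2 * q)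
  identity = solve 2 (λ l q → (con 1 :+ l) :* q :+ (con 1 :+ l) :* q :+ con 2 :* q
                            := (con 2 :+ l) :* (con 2 :* q)) refl

mult-Layered-suc : ∀ L (S : VSet (order (suc L))) d →
  let open DisjointUnion (Layered L ⊕ Layered L) (Complete (2 ^ suc L)) S
      open DisjointUnion (Layered L) (Layered L) Sˡ
        renaming (Sˡ to Sˡˡ; Sʳ to Sˡʳ; mult-⊕ to mult-⊕ˡ) in
  mult (Layered (suc L)) S d ≡
    mult (Layered L) Sˡˡ d + mult (Layered L) Sˡʳ d + mult (Complete (2 ^ suc L)) Sʳ d
mult-Layered-suc L S d =
  let open DisjointUnion (Layered L ⊕ Layered L) (Complete (2 ^ suc L)) S
      open DisjointUnion (Layered L) (Layered L) Sˡ
        renaming (Sˡ to Sˡˡ; Sʳ to Sˡʳ; mult-⊕ to mult-⊕ˡ) in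
  trans (mult-⊕ d) (cong (_+ mult (Complete (2 ^ suc L)) Sʳ d) (mult-⊕ˡ d))

mult-Layered : ∀ L (S : VSet (order L)) d → mult (Layered L) S d ≤ 2 ^ suc L ∸ suc d
mult-Layered zero    S d = clique-step {p = 1} z≤n z≤n (mult-complete 1 S d)
mult-Layered (suc L) S d =
  subst (_≤ 2 ^ suc (suc L) ∸ suc d) (≡-sym (mult-Layered-suc L S d))
    (clique-step {p = 2 ^ suc L} (mult-Layered L _ d) (mult-Layered L _ d) (mult-complete _ _ d))

repetition-Layered : ∀ L (S : VSet (order L)) → repetition (Layered L) S ≤ 2 ^ suc L
repetition-Layered L S =
  repetition-≤ (Layered L) S _ (λ d → ≤-trans (mult-Layered L S d) (m∸n≤m _ (suc d)))

level-bound : ∀ L {k} C → Admissible k C → 2 ^ suc L < k → suc L * 2 ^ L ≤ C + 2 ^ suc L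
level-bound L C adm small = subst (_≤ C + 2 ^ suc L) (order-closed L)
  (admissible-lower-bound C adm (Layered L) (repetition-Layered L) small)

-- 2^⌊log₂ k⌋ ≤ k for k ≥ 1, by induction on the value of the logarithm,
-- halving k at each step.
pow-⌊log₂⌋-≤ : ∀ ℓ k → ⌊log₂ k ⌋ ≡ ℓ → 1 ≤ k → 2 ^ ℓ ≤ k
pow-⌊log₂⌋-≤ zero    k                 _    1≤k = 1≤k
pow-⌊log₂⌋-≤ (suc ℓ) k@(suc (suc _)) log≡ _   = begin
  2 * 2 ^ ℓ    ≤⟨ *-monoʳ-≤ 2 half-bound ⟩
  2 * h        ≡⟨ cong (h +_) (+-identityʳ h) ⟩
  h + h        ≤⟨ +-monoʳ-≤ h (⌊n/2⌋≤⌈n/2⌉ k) ⟩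
  h + ⌈ k /2⌉  ≡⟨ ⌊n/2⌋+⌈n/2⌉≡n k ⟩
  k            ∎
  where
  open ≤-Reasoning
  h = ⌊ k /2⌋
  half-bound : 2 ^ ℓ ≤ h
  half-bound = pow-⌊log₂⌋-≤ ℓ h (trans (⌊log₂⌊n/2⌋⌋≡⌊log₂n⌋∸1 k) (cong (_∸ 1) log≡)) (s≤s z≤n)

-- k < 2^(⌊log₂ k⌋ + 1): otherwise monotonicity of ⌊log₂⌋ would give
-- ⌊log₂ k⌋ + 1 ≤ ⌊log₂ k⌋.
<-pow-suc-⌊log₂⌋ : ∀ k → k < 2 ^ suc ⌊log₂ k ⌋
<-pow-suc-⌊log₂⌋ k with 2 ^ suc ⌊log₂ k ⌋ ≤? k
... | no  big   = ≰⇒> big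
... | yes small = ⊥-elim (<-irrefl refl
      (subst (_≤ ⌊log₂ k ⌋) (⌊log₂[2^n]⌋≡n _) (⌊log₂⌋-mono-≤ small)))

-- The final arithmetic, with ⌊log₂ k⌋ = m + 4 and p = 2^{m+2}: from k ≤ 8p and
-- (m+3)p ≤ C + 2p we get (m+1)p ≤ C, hence k(m+4) ≤ 8p(m+4) ≤ 32(m+1)p ≤ 32C.
final-estimate : ∀ m p k C → k ≤ 8 * p → (3 + m) * p ≤ C + 2 * p → k * (4 + m) ≤ 32 * C
final-estimate m p k C k≤8p level = begin
  k * (4 + m)                     ≤⟨ *-monoˡ-≤ (4 + m) k≤8p ⟩
  8 * p * (4 + m)                 ≤⟨ m≤m+n _ _ ⟩
  8 * p * (4 + m) + 24 * (m * p)  ≡⟨ expand m p ⟩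
  32 * ((1 + m) * p)              ≤⟨ *-monoʳ-≤ 32 C-bound ⟩
  32 * C                          ∎
  where
  open ≤-Reasoning
  open +-*-Solver
  split : ∀ m p → (3 + m) * p ≡ 2 * p + (1 + m) * p
  split = solve 2 (λ m p → (con 3 :+ m) :* p := con 2 :* p :+ (con 1 :+ m) :* p) refl
  expand : ∀ m p → 8 * p * (4 + m) + 24 * (m * p) ≡ 32 * ((1 + m) * p)
  expand = solve 2 (λ m p → con 8 :* p :* (con 4 :+ m) :+ con 24 :* (m :* p)
                          := con 32 :* ((con 1 :+ m) :* p)) refl
  C-bound : (1 + m) * p ≤ C
  C-bound = +-cancelˡ-≤ (2 * p) _ _ (subst₂ _≤_ (split m p) (+-comm C (2 * p)) level)

-- Main theorem: C(k) ≥ k·⌊log₂ k⌋ / 32 for all k ≥ 16.  Write ⌊log₂ k⌋ = m + 4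
-- and apply the level bound to G_{m+2}, whose repetition numbers are at most
-- 2^{m+3} < 2^{m+4} ≤ k.
theorem5p2 : ∃₂ λ (a K : ℕ) → ∀ k → K ≤ k → ∀ C → Admissible k C →
    k * ⌊log₂ k ⌋ ≤ a * C
theorem5p2 = 32 , 16 , bound
  where
  bound : ∀ k → 16 ≤ k → ∀ C → Admissible k C → k * ⌊log₂ k ⌋ ≤ 32 * C
  bound k 16≤k C adm = subst (λ ℓ → k * ℓ ≤ 32 * C) (≡-sym ℓ≡)
    (final-estimate m p k C k≤8p (level-bound (2 + m) C adm 2^[m+3]<k))
    where
    4≤ℓ : 4 ≤ ⌊log₂ k ⌋
    4≤ℓ = subst (_≤ ⌊log₂ k ⌋) (⌊log₂[2^n]⌋≡n 4) (⌊log₂⌋-mono-≤ 16≤k)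
    m = ⌊log₂ k ⌋ ∸ 4
    ℓ≡ : ⌊log₂ k ⌋ ≡ 4 + m
    ℓ≡ = ≡-sym (m+[n∸m]≡n 4≤ℓ)
    p = 2 ^ (2 + m)
    2^[m+3]<k : 2 ^ (3 + m) < k
    2^[m+3]<k = <-≤-trans (^-monoʳ-< 2 (s≤s (s≤s z≤n)) (n<1+n (3 + m)))
                          (pow-⌊log₂⌋-≤ (4 + m) k ℓ≡ (≤-trans (s≤s z≤n) 16≤k))
    k≤8p : k ≤ 8 * p
    k≤8p = <⇒≤ (subst (k <_) (trans (cong (λ ℓ → 2 ^ suc ℓ) ℓ≡) (eight p)) (<-pow-suc-⌊log₂⌋ k))
      where
      open +-*-Solver
      eight : ∀ q → 2 * (2 * (2 * q)) ≡ 8 * q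
      eight = solve 1 (λ q → con 2 :* (con 2 :* (con 2 :* q)) := con 8 :* q) refl
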